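{- Let $\Gamma=(V,E)$, $B$, $\mathbb{K}$, $u$ be as in the context. If some vertex in $V\setminus B$ is adjacent to at least $3$ boundary nodes, then for every total ordering of $\mathcal{A}(\Gamma,u)$ the minimal broken circuits of $\mathcal{A}(\Gamma,u)$ are not pairwise disjoint.
   Context: $\Gamma=(V,E)$ is a finite connected graph without loops or multiple edges; $B\subseteq V$ is a set of at least $2$ pairwise nonadjacent vertices (boundary nodes); $\mathbb{K}$ is a field of characteristic $0$; $u:B\to\mathbb{K}$ is injective. $\mathcal{A}(\Gamma,u)$ is the central arrangement in $\mathbb{K}^{(V\setminus B)\cup\{0\}}$ consisting of: for each edge $ij\in E$ with no endpoint in $B$, the hyperplane $x_i=x_j$; for each edge $ij$ with $j\in B$, the hyperplane $x_i=u(j)x_0$; and the hyperplane $x_0=0$. A circuit is a minimal set of hyperplanes whose normal vectors are linearly dependent. Given a total order on the arrangement, the broken circuits are the sets $C\setminus\min C$ for circuits $C$; a broken circuit is minimal if it properly contains no other broken circuit. -}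

module Defs where

open import Level using (Level)
open import Algebra.Bundles using (CommutativeRing)
open import Data.Nat as ℕ using (ℕ; zero; suc)
open import Data.Fin using (Fin)
import Data.Fin as Fin
open import Data.Fin.Properties using () renaming (_≟_ to _≟ᶠ_)
open import Data.Maybe using (Maybe; just; nothing)
open import Data.Maybe.Properties using (≡-dec)
open import Data.Bool using (Bool; true; false; if_then_else_)
open import Data.Product using (Σ; ∃; _×_; _,_)
open import Data.Unit using (⊤)
open import Relation.Nullary using (¬_; Dec; yes; no)
open import Relation.Binary.PropositionalEquality using (_≡_; _≢_)

module _ {c ℓ : Level} (K : CommutativeRing c ℓ) where
  open CommutativeRing K

  fromℕ : ℕ → Carrier
  fromℕ zero    = 0#
  fromℕ (suc k) = 1# + fromℕ k

  IsField : Set (c Level.⊔ ℓ)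
  IsField = (¬ (1# ≈ 0#)) × (∀ x → ¬ (x ≈ 0#) → Σ Carrier λ y → (x * y) ≈ 1#)

  CharZero : Set ℓ
  CharZero = ∀ k → ¬ (fromℕ (suc k) ≈ 0#)

Adj : ℕ → Set
Adj n = Fin n → Fin n → Bool

data Reach {n : ℕ} (adj : Adj n) : Fin n → Fin n → Set where
  here : ∀ {i} → Reach adj i i
  step : ∀ {i k j} → adj i k ≡ true → Reach adj k j → Reach adj i j

IsSimpleConnectedGraph : (n : ℕ) → Adj n → Set
IsSimpleConnectedGraph n adj =
  (∀ i j → adj i j ≡ adj j i) ×
  (∀ i → adj i i ≡ false) ×
  (∀ i j → Reach adj i j)

IsBoundary : (n : ℕ) → Adj n → (Fin n → Bool) → Set
IsBoundary n adj B =
  (Σ (Fin n) λ b₁ → Σ (Fin n) λ b₂ → b₁ ≢ b₂ × B b₁ ≡ true × B b₂ ≡ true) ×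
  (∀ i j → B i ≡ true → B j ≡ true → adj i j ≡ false)

module Arrangement {c ℓ : Level} (K : CommutativeRing c ℓ)
                   (n : ℕ) (adj : Adj n) (B : Fin n → Bool)
                   (u : Fin n → CommutativeRing.Carrier K) where
  open CommutativeRing K

  -- Coordinates of the ambient space K^{(V∖B) ∪ {0}}:
  -- nothing = the coordinate x₀, just v (with B v ≡ false) = x_v.
  Coord : Set
  Coord = Maybe (Fin n)

  InAmbient : Coord → Set
  InAmbient nothing  = ⊤
  InAmbient (just v) = B v ≡ false

  e : Coord → Coord → Carrier
  e y x with ≡-dec _≟ᶠ_ y x
  ... | yes _ = 1#
  ... | no  _ = 0#

  -- Hyperplane labels: nothing = the hyperplane x₀ = 0;
  -- just (i , j) with i < j and ij ∈ E = the hyperplane of the edge ij.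
  Hyp : Set
  Hyp = Maybe (Fin n × Fin n)

  Valid : Hyp → Set
  Valid nothing        = ⊤
  Valid (just (i , j)) = (i Fin.< j) × (adj i j ≡ true)

  normal : Hyp → Coord → Carrier
  normal nothing x = e nothing x
  normal (just (i , j)) x with B i | B j
  ... | false | false = e (just i) x - e (just j) x
  ... | false | true  = e (just i) x - u j * e nothing x
  ... | true  | false = e (just j) x - u i * e nothing x
  ... | true  | true  = 0#                               -- never an edge

  sumFin : ∀ {m} → (Fin m → Carrier) → Carrier
  sumFin {zero}  f = 0#
  sumFin {suc m} f = f Fin.zero + sumFin (λ k → f (Fin.suc k))

  lincomb : (Hyp → Carrier) → Coord → Carrier
  lincomb cf x = cf nothing * normal nothing x
               + sumFin (λ i → sumFin (λ j → cf (just (i , j)) * normal (just (i , j)) x))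

  HSet : Set
  HSet = Hyp → Bool

  _⊆_ : HSet → HSet → Set
  S ⊆ T = ∀ h → S h ≡ true → T h ≡ true

  _⊂_ : HSet → HSet → Set
  S ⊂ T = (S ⊆ T) × (Σ Hyp λ h → T h ≡ true × S h ≡ false)

  InArr : HSet → Set
  InArr S = ∀ h → S h ≡ true → Valid h

  Dependent : HSet → Set (c Level.⊔ ℓ)
  Dependent S = Σ (Hyp → Carrier) λ cf →
      (∀ h → S h ≡ false → cf h ≈ 0#) ×
      (Σ Hyp λ h → S h ≡ true × ¬ (cf h ≈ 0#)) ×
      (∀ x → InAmbient x → lincomb cf x ≈ 0#)

  Circuit : HSet → Set (c Level.⊔ ℓ)
  Circuit C = InArr C × Dependent C × (∀ T → T ⊂ C → ¬ Dependent T)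

  -- a total order on the arrangement, given by an injective rank function
  IsTotalOrder : (Hyp → ℕ) → Set
  IsTotalOrder rank = ∀ h h' → Valid h → Valid h' → rank h ≡ rank h' → h ≡ h'

  module _ (rank : Hyp → ℕ) where

    IsMin : HSet → Hyp → Set
    IsMin C h = C h ≡ true × (∀ h' → C h' ≡ true → rank h ℕ.≤ rank h')

    BrokenCircuit : HSet → Set (c Level.⊔ ℓ)
    BrokenCircuit S = Σ HSet λ C → Circuit C × Σ Hyp λ h → IsMin C h ×
      S h ≡ false × (∀ x → x ≢ h → S x ≡ C x)

    MinimalBrokenCircuit : HSet → Set (c Level.⊔ ℓ)
    MinimalBrokenCircuit S = BrokenCircuit S × (∀ T → T ⊂ S → ¬ BrokenCircuit T)

    MBCNotPairwiseDisjoint : Set (c Level.⊔ ℓ)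
    MBCNotPairwiseDisjoint = Σ HSet λ S → Σ HSet λ T →
      MinimalBrokenCircuit S × MinimalBrokenCircuit T ×
      (Σ Hyp λ x → S x ≢ T x) ×
      (Σ Hyp λ h → S h ≡ true × T h ≡ true)

module Submission where

-- The four "star" hyperplanes x₀ = 0 and x_v = u(bₖ) x₀
-- have normals e₀ and e_v − u(bₖ) e₀, all lying in the plane spanned by
-- e_v and e₀.  Hence any three of them form a circuit (they are dependent,
-- by the cofactor identity for three vectors of a plane, and any two of
-- them are independent because u is injective).  Let a be the star
-- hyperplane of least rank and x, y, z the other three.  Then {x, y} and
-- {x, z} are broken circuits (of {a, x, y} and {a, x, z}), and they are
-- minimal: a smaller broken circuit would come from a circuit inside
-- {h, y} (or {h, x}, ...) for some hyperplane h, but a valid hyperplane and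
-- a distinct star hyperplane always have independent normals.  The two
-- minimal broken circuits are distinct and share x.

open import Level using (Level)
open import Algebra.Bundles using (CommutativeRing)
open import Algebra.Solver.Ring.AlmostCommutativeRing
  using (fromCommutativeRing; _-Raw-AlmostCommutative⟶_)
open import Data.Bool using (Bool; true; false)
open import Data.Empty using (⊥; ⊥-elim)
open import Data.Fin as Fin using (Fin; zero; suc; punchIn)
open import Data.Fin.Patterns using (0F; 1F; 2F; 3F)
open import Data.Fin.Properties as FinP using (punchInᵢ≢i) renaming (_≟_ to _≟ᶠ_)
open import Data.Integer as ℤ using (ℤ; +_; -[1+_])
import Data.Integer.Properties as ℤP
open import Data.List using (List; []; _∷_)
open import Data.List.Relation.Unary.Any using (here; there; _─_)
open import Data.Maybe using (Maybe; just; nothing)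
open import Data.Maybe.Properties using (just-injective) renaming (≡-dec to Maybe-≡-dec)
open import Data.Nat as ℕ using (ℕ; zero; suc)
import Data.Nat.Properties as ℕP
open import Data.Product using (Σ; _×_; _,_; proj₁; proj₂)
open import Data.Product.Properties using (,-injectiveˡ; ,-injectiveʳ)
  renaming (≡-dec to ×-≡-dec)
open import Data.Sign as Sign using (Sign)
open import Data.Sum using (_⊎_; inj₁; inj₂)
open import Data.Unit using (tt)
open import Function using (_∘_)
open import Relation.Binary.Definitions using (DecidableEquality; tri<; tri≈; tri>)
open import Relation.Binary.PropositionalEquality as ≡ using (_≡_; _≢_)
open import Relation.Nullary using (¬_; Dec; yes; no; does)
open import Relation.Nullary.Decidable using (dec-true; dec-false)
open import Defs

-- Integers act on the ring
-- through n ↦ n ×ₘ 1#; the optimised multiple makes 0 and 1 evaluate to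
-- 0# and 1# definitionally, so solved identities may mention them.
module IntegerCoefficientSolver {c ℓ} (K : CommutativeRing c ℓ) where
  open CommutativeRing K
  open import Algebra.Properties.Semiring.Mult.TCOptimised semiring
    using (×-homo-+; ×1-homo-*) renaming (_×_ to _×ₘ_)
  open import Algebra.Properties.Ring ring using (-‿distribˡ-*; -‿distribʳ-*)
  open import Algebra.Properties.Group +-group using (ε⁻¹≈ε; ⁻¹-involutive)
  open import Algebra.Properties.AbelianGroup +-abelianGroup using (⁻¹-∙-comm)
  open import Algebra.Properties.CommutativeSemigroup +-commutativeSemigroup
    using (interchange)
  open import Relation.Binary.Reasoning.Setoid setoid

  ⟦_⟧ℤ : ℤ → Carrier
  ⟦ + m ⟧ℤ      = m ×ₘ 1#
  ⟦ -[1+ m ] ⟧ℤ = - (suc m ×ₘ 1#)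

  ⊖-homo : ∀ m n → ⟦ m ℤ.⊖ n ⟧ℤ ≈ m ×ₘ 1# - n ×ₘ 1#
  ⊖-homo m       zero    = sym (trans (+-congˡ ε⁻¹≈ε) (+-identityʳ _))
  ⊖-homo zero    (suc n) = sym (+-identityˡ _)
  ⊖-homo (suc m) (suc n) rewrite ℤP.[1+m]⊖[1+n]≡m⊖n m n = begin
    ⟦ m ℤ.⊖ n ⟧ℤ                          ≈⟨ ⊖-homo m n ⟩
    m ×ₘ 1# - n ×ₘ 1#                     ≈⟨ +-identityˡ _ ⟨
    0# + (m ×ₘ 1# - n ×ₘ 1#)              ≈⟨ +-congʳ (-‿inverseʳ 1#) ⟨
    (1# - 1#) + (m ×ₘ 1# - n ×ₘ 1#)       ≈⟨ interchange 1# (- 1#) (m ×ₘ 1#) (- (n ×ₘ 1#)) ⟩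
    (1# + m ×ₘ 1#) + (- 1# - n ×ₘ 1#)     ≈⟨ +-congˡ (⁻¹-∙-comm 1# (n ×ₘ 1#)) ⟩
    (1# + m ×ₘ 1#) - (1# + n ×ₘ 1#)       ≈⟨ +-cong (×-homo-+ 1# 1 m) (-‿cong (×-homo-+ 1# 1 n)) ⟨
    suc m ×ₘ 1# - suc n ×ₘ 1#             ∎

  +-homo : ∀ i j → ⟦ i ℤ.+ j ⟧ℤ ≈ ⟦ i ⟧ℤ + ⟦ j ⟧ℤ
  +-homo (+ m)    (+ n)    = ×-homo-+ 1# m n
  +-homo (+ m)    -[1+ n ] = ⊖-homo m (suc n)
  +-homo -[1+ m ] (+ n)    = trans (⊖-homo n (suc m)) (+-comm _ _)
  +-homo -[1+ m ] -[1+ n ] = begin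
    - (suc (suc (m ℕ.+ n)) ×ₘ 1#)    ≈⟨ -‿cong (reflexive (≡.cong (λ k → suc k ×ₘ 1#) (ℕP.+-suc m n))) ⟨
    - ((suc m ℕ.+ suc n) ×ₘ 1#)      ≈⟨ -‿cong (×-homo-+ 1# (suc m) (suc n)) ⟩
    - (suc m ×ₘ 1# + suc n ×ₘ 1#)    ≈⟨ ⁻¹-∙-comm _ _ ⟨
    - (suc m ×ₘ 1#) - (suc n ×ₘ 1#)  ∎

  -‿homo : ∀ i → ⟦ ℤ.- i ⟧ℤ ≈ - ⟦ i ⟧ℤ
  -‿homo (+ zero)  = sym ε⁻¹≈ε
  -‿homo (+ suc n) = refl
  -‿homo -[1+ n ]  = sym (⁻¹-involutive _)

  signed : Sign → Carrier → Carrier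
  signed Sign.+ x = x
  signed Sign.- x = - x

  ◃-homo : ∀ s m → ⟦ s ℤ.◃ m ⟧ℤ ≈ signed s (m ×ₘ 1#)
  ◃-homo Sign.+ zero    = refl
  ◃-homo Sign.- zero    = sym ε⁻¹≈ε
  ◃-homo Sign.+ (suc m) = refl
  ◃-homo Sign.- (suc m) = refl

  signed-cong : ∀ s {x y} → x ≈ y → signed s x ≈ signed s y
  signed-cong Sign.+ x≈y = x≈y
  signed-cong Sign.- x≈y = -‿cong x≈y

  signed-* : ∀ s t x y → signed (s Sign.* t) (x * y) ≈ signed s x * signed t y
  signed-* Sign.+ Sign.+ x y = refl
  signed-* Sign.+ Sign.- x y = -‿distribʳ-* x y
  signed-* Sign.- Sign.+ x y = -‿distribˡ-* x y
  signed-* Sign.- Sign.- x y = begin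
    x * y         ≈⟨ ⁻¹-involutive _ ⟨
    - - (x * y)   ≈⟨ -‿cong (-‿distribʳ-* x y) ⟩
    - (x * - y)   ≈⟨ -‿distribˡ-* x (- y) ⟩
    - x * - y     ∎

  -- i * j is computed as (sign i · sign j) ◃ (∣i∣ · ∣j∣), and ⟦ i ⟧ℤ is
  -- definitionally  signed (sign i) (∣ i ∣ ×ₘ 1#).
  *-homo : ∀ i j → ⟦ i ℤ.* j ⟧ℤ ≈ ⟦ i ⟧ℤ * ⟦ j ⟧ℤ
  *-homo i j = begin
    ⟦ i ℤ.* j ⟧ℤ
      ≈⟨ ◃-homo (ℤ.sign i Sign.* ℤ.sign j) (ℤ.∣ i ∣ ℕ.* ℤ.∣ j ∣) ⟩
    signed (ℤ.sign i Sign.* ℤ.sign j) ((ℤ.∣ i ∣ ℕ.* ℤ.∣ j ∣) ×ₘ 1#)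
      ≈⟨ signed-cong (ℤ.sign i Sign.* ℤ.sign j) (×1-homo-* ℤ.∣ i ∣ ℤ.∣ j ∣) ⟩
    signed (ℤ.sign i Sign.* ℤ.sign j) ((ℤ.∣ i ∣ ×ₘ 1#) * (ℤ.∣ j ∣ ×ₘ 1#))
      ≈⟨ signed-* (ℤ.sign i) (ℤ.sign j) _ _ ⟩
    signed (ℤ.sign i) (ℤ.∣ i ∣ ×ₘ 1#) * signed (ℤ.sign j) (ℤ.∣ j ∣ ×ₘ 1#)
      ≈⟨ *-cong (signed-abs i) (signed-abs j) ⟩
    ⟦ i ⟧ℤ * ⟦ j ⟧ℤ ∎
    where
    signed-abs : ∀ k → signed (ℤ.sign k) (ℤ.∣ k ∣ ×ₘ 1#) ≈ ⟦ k ⟧ℤ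
    signed-abs (+ m)    = refl
    signed-abs -[1+ m ] = refl

  ℤ⟶K : ℤ.+-*-rawRing -Raw-AlmostCommutative⟶ fromCommutativeRing K
  ℤ⟶K = record
    { ⟦_⟧ = ⟦_⟧ℤ ; +-homo = +-homo ; *-homo = *-homo ; -‿homo = -‿homo
    ; 0-homo = refl ; 1-homo = refl }

  equal? : ∀ i j → Maybe (⟦ i ⟧ℤ ≈ ⟦ j ⟧ℤ)
  equal? i j with i ℤ.≟ j
  ... | yes ≡.refl = just refl
  ... | no _       = nothing

  open import Algebra.Solver.Ring ℤ.+-*-rawRing (fromCommutativeRing K) ℤ⟶K equal? public

argmin : ∀ {m} (f : Fin (suc m) → ℕ) → Σ (Fin (suc m)) λ a → ∀ k → f a ℕ.≤ f k
argmin {zero}  f = zero , λ { zero → ℕP.≤-refl }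
argmin {suc m} f with argmin (f ∘ suc)
... | a , a-min with f zero ℕ.≤? f (suc a)
...   | yes f0≤fa = zero , λ { zero → ℕP.≤-refl ; (suc k) → ℕP.≤-trans f0≤fa (a-min k) }
...   | no  f0≰fa = suc a , λ { zero → ℕP.<⇒≤ (ℕP.≰⇒> f0≰fa) ; (suc k) → a-min k }

record Complement (a : Fin 4) : Set where
  constructor complement
  field
    x y z : Fin 4
    a≢x : a ≢ x
    a≢y : a ≢ y
    a≢z : a ≢ z
    x≢y : x ≢ y
    x≢z : x ≢ z
    y≢z : y ≢ z

complement-of : ∀ a → Complement a
complement-of 0F = complement 1F 2F 3F (λ ()) (λ ()) (λ ()) (λ ()) (λ ()) (λ ())
complement-of 1F = complement 0F 2F 3F (λ ()) (λ ()) (λ ()) (λ ()) (λ ()) (λ ())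
complement-of 2F = complement 0F 1F 3F (λ ()) (λ ()) (λ ()) (λ ()) (λ ()) (λ ())
complement-of 3F = complement 0F 1F 2F (λ ()) (λ ()) (λ ()) (λ ()) (λ ()) (λ ())

module PlaneIdentity {c ℓ} (K : CommutativeRing c ℓ) where
  open CommutativeRing K
  open IntegerCoefficientSolver K

  det₂ : Carrier → Carrier → Carrier → Carrier → Carrier
  det₂ x₁ y₁ x₂ y₂ = x₁ * y₂ - x₂ * y₁

  cofactor-relation : ∀ x₁ y₁ x₂ y₂ x₃ y₃ p q →
    det₂ x₂ y₂ x₃ y₃ * (x₁ * p + y₁ * q) +
    (det₂ x₃ y₃ x₁ y₁ * (x₂ * p + y₂ * q) + det₂ x₁ y₁ x₂ y₂ * (x₃ * p + y₃ * q)) ≈ 0#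
  cofactor-relation = solve 8 (λ x₁ y₁ x₂ y₂ x₃ y₃ p q →
    (x₂ :* y₃ :- x₃ :* y₂) :* (x₁ :* p :+ y₁ :* q) :+
    ((x₃ :* y₁ :- x₁ :* y₃) :* (x₂ :* p :+ y₂ :* q) :+ (x₁ :* y₂ :- x₂ :* y₁) :* (x₃ :* p :+ y₃ :* q))
    := con (+ 0)) refl

module FieldFacts {c ℓ} (K : CommutativeRing c ℓ) (isField : IsField K) where
  open CommutativeRing K
  open import Algebra.Properties.Group +-group using (ε⁻¹≈ε; ⁻¹-involutive; x∙y⁻¹≈ε⇒x≈y)
  open import Relation.Binary.Reasoning.Setoid setoid

  1≉0 : ¬ 1# ≈ 0#
  1≉0 = proj₁ isField

  cancel : ∀ {x y} → ¬ y ≈ 0# → x * y ≈ 0# → x ≈ 0#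
  cancel {x} {y} y≉0 xy≈0 with proj₂ isField y y≉0
  ... | y⁻¹ , yy⁻¹≈1 = begin
    x              ≈⟨ *-identityʳ x ⟨
    x * 1#         ≈⟨ *-congˡ yy⁻¹≈1 ⟨
    x * (y * y⁻¹)  ≈⟨ *-assoc x y y⁻¹ ⟨
    (x * y) * y⁻¹  ≈⟨ *-congʳ xy≈0 ⟩
    0# * y⁻¹       ≈⟨ zeroˡ y⁻¹ ⟩
    0#             ∎

  ≈1⇒≉0 : ∀ {x} → x ≈ 1# → ¬ x ≈ 0#
  ≈1⇒≉0 x≈1 x≈0 = 1≉0 (trans (sym x≈1) x≈0)

  ≈-1⇒≉0 : ∀ {x} → x ≈ - 1# → ¬ x ≈ 0#
  ≈-1⇒≉0 x≈-1 x≈0 =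
    1≉0 (trans (sym (⁻¹-involutive 1#)) (trans (-‿cong (trans (sym x≈-1) x≈0)) ε⁻¹≈ε))

  difference-zero : ∀ {x y} → x - y ≈ 0# → x ≈ y
  difference-zero = x∙y⁻¹≈ε⇒x≈y _ _

module ArrangementFacts {c ℓ} (K : CommutativeRing c ℓ) (n : ℕ) (adj : Adj n)
                        (B : Fin n → Bool) (u : Fin n → CommutativeRing.Carrier K) where
  open CommutativeRing K hiding (zero)
  open Arrangement K n adj B u
  open import Algebra.Properties.CommutativeMonoid.Sum +-commutativeMonoid
    using (sum; sum-cong-≋; sum-remove; sum-replicate-zero; ∑-distrib-+)
  open import Algebra.Properties.CommutativeSemigroup +-commutativeSemigroup
    using (interchange)
  open import Algebra.Properties.Group +-group using (ε⁻¹≈ε)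
  open import Relation.Binary.Reasoning.Setoid setoid

  -- Sums over Fin m.  Defs sums with sumFin, which agrees with the
  -- library's sum of vectors, so the library's lemmas about sum apply.

  sumFin≡sum : ∀ {m} (f : Fin m → Carrier) → sumFin f ≡ sum f
  sumFin≡sum {zero}  f = ≡.refl
  sumFin≡sum {suc m} f = ≡.cong (λ s → f zero + s) (sumFin≡sum (f ∘ suc))

  ∑-zero : ∀ {m} {f : Fin m → Carrier} → (∀ i → f i ≈ 0#) → sum f ≈ 0#
  ∑-zero {m} f≈0 = trans (sum-cong-≋ f≈0) (sum-replicate-zero m)

  ∑-single : ∀ {m} {f : Fin m → Carrier} (k : Fin m) → (∀ i → i ≢ k → f i ≈ 0#) → sum f ≈ f k
  ∑-single {suc m} {f} k f≈0 = begin
    sum f                      ≈⟨ sum-remove {i = k} f ⟩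
    f k + sum (f ∘ punchIn k)  ≈⟨ +-congˡ (∑-zero (λ j → f≈0 (punchIn k j) (punchInᵢ≢i k j))) ⟩
    f k + 0#                   ≈⟨ +-identityʳ (f k) ⟩
    f k                        ∎

  Σᴴ : (Hyp → Carrier) → Carrier
  Σᴴ F = F nothing + sum (λ i → sum (λ j → F (just (i , j))))

  Σᴴ-cong : ∀ {F G} → (∀ h → F h ≈ G h) → Σᴴ F ≈ Σᴴ G
  Σᴴ-cong F≈G = +-cong (F≈G nothing) (sum-cong-≋ (λ i → sum-cong-≋ (λ j → F≈G (just (i , j)))))

  Σᴴ-+ : ∀ F G → Σᴴ (λ h → F h + G h) ≈ Σᴴ F + Σᴴ G
  Σᴴ-+ F G = trans (+-congˡ (trans (sum-cong-≋ (λ i → ∑-distrib-+ (row F i) (row G i)))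
                                    (∑-distrib-+ (sum ∘ row F) (sum ∘ row G))))
                   (interchange _ _ _ _)
    where
    row : (Hyp → Carrier) → Fin n → Fin n → Carrier
    row H i j = H (just (i , j))

  Σᴴ-single : ∀ {F} p → (∀ h → h ≢ p → F h ≈ 0#) → Σᴴ F ≈ F p
  Σᴴ-single nothing F≈0 =
    trans (+-congˡ (∑-zero (λ i → ∑-zero (λ j → F≈0 (just (i , j)) λ ())))) (+-identityʳ _)
  Σᴴ-single {F} (just (i , j)) F≈0 = begin
    Σᴴ F                                    ≈⟨ +-cong (F≈0 nothing λ ()) (∑-single i other-rows) ⟩
    0# + sum (λ j' → F (just (i , j')))     ≈⟨ +-identityˡ _ ⟩
    sum (λ j' → F (just (i , j')))          ≈⟨ ∑-single j other-columns ⟩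
    F (just (i , j))                        ∎
    where
    other-rows : ∀ i' → i' ≢ i → sum (λ j' → F (just (i' , j'))) ≈ 0#
    other-rows i' i'≢i = ∑-zero (λ j' → F≈0 (just (i' , j')) (i'≢i ∘ ,-injectiveˡ ∘ just-injective))
    other-columns : ∀ j' → j' ≢ j → F (just (i , j')) ≈ 0#
    other-columns j' j'≢j = F≈0 (just (i , j')) (j'≢j ∘ ,-injectiveʳ ∘ just-injective)

  term : (Hyp → Carrier) → Coord → Hyp → Carrier
  term cf x h = cf h * normal h x

  lincomb≈Σᴴ : ∀ cf x → lincomb cf x ≈ Σᴴ (term cf x)
  lincomb≈Σᴴ cf x = +-congˡ (trans (reflexive (sumFin≡sum (λ i → sumFin (row i))))
                                   (sum-cong-≋ (λ i → reflexive (sumFin≡sum (row i)))))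
    where
    row : Fin n → Fin n → Carrier
    row i j = cf (just (i , j)) * normal (just (i , j)) x

  _≟ᴴ_ : DecidableEquality Hyp
  _≟ᴴ_ = Maybe-≡-dec (×-≡-dec _≟ᶠ_ _≟ᶠ_)

  point : Hyp → Carrier → Hyp → Carrier
  point p γ h with h ≟ᴴ p
  ... | yes _ = γ
  ... | no  _ = 0#

  point-at : ∀ p γ → point p γ p ≈ γ
  point-at p γ with p ≟ᴴ p
  ... | yes _   = refl
  ... | no p≢p  = ⊥-elim (p≢p ≡.refl)

  point-off : ∀ {p h} γ → h ≢ p → point p γ h ≈ 0#
  point-off {p} {h} γ h≢p with h ≟ᴴ p
  ... | yes h≡p = ⊥-elim (h≢p h≡p)
  ... | no  _   = refl

  lincomb-cong : ∀ {cf cg} → (∀ h → cf h ≈ cg h) → ∀ x → lincomb cf x ≈ lincomb cg x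
  lincomb-cong {cf} {cg} cf≈cg x =
    trans (lincomb≈Σᴴ cf x)
          (trans (Σᴴ-cong {term cf x} {term cg x} (λ h → *-congʳ (cf≈cg h))) (sym (lincomb≈Σᴴ cg x)))

  lincomb-+ : ∀ cf cg x → lincomb (λ h → cf h + cg h) x ≈ lincomb cf x + lincomb cg x
  lincomb-+ cf cg x = begin
    lincomb (λ h → cf h + cg h) x
      ≈⟨ lincomb≈Σᴴ (λ h → cf h + cg h) x ⟩
    Σᴴ (term (λ h → cf h + cg h) x)
      ≈⟨ Σᴴ-cong {term (λ h → cf h + cg h) x} (λ h → distribʳ (normal h x) (cf h) (cg h)) ⟩
    Σᴴ (λ h → term cf x h + term cg x h)
      ≈⟨ Σᴴ-+ (term cf x) (term cg x) ⟩
    Σᴴ (term cf x) + Σᴴ (term cg x)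
      ≈⟨ +-cong (lincomb≈Σᴴ cf x) (lincomb≈Σᴴ cg x) ⟨
    lincomb cf x + lincomb cg x
      ∎

  lincomb-point : ∀ p γ x → lincomb (point p γ) x ≈ γ * normal p x
  lincomb-point p γ x = begin
    lincomb (point p γ) x
      ≈⟨ lincomb≈Σᴴ (point p γ) x ⟩
    Σᴴ (term (point p γ) x)
      ≈⟨ Σᴴ-single {term (point p γ) x} p (λ h h≢p → trans (*-congʳ (point-off γ h≢p)) (zeroˡ _)) ⟩
    point p γ p * normal p x
      ≈⟨ *-congʳ (point-at p γ) ⟩
    γ * normal p x
      ∎

  open import Data.List.Membership.DecPropositional _≟ᴴ_ using (_∈_; _∉_; _∈?_)

  ⟪_⟫ : List Hyp → HSet
  ⟪ L ⟫ h = does (h ∈? L)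

  ∈⇒⟪⟫ : ∀ {L h} → h ∈ L → ⟪ L ⟫ h ≡ true
  ∈⇒⟪⟫ {L} {h} = dec-true (h ∈? L)

  ∉⇒⟪⟫ : ∀ {L h} → h ∉ L → ⟪ L ⟫ h ≡ false
  ∉⇒⟪⟫ {L} {h} = dec-false (h ∈? L)

  ⟪⟫⇒∈ : ∀ {L h} → ⟪ L ⟫ h ≡ true → h ∈ L
  ⟪⟫⇒∈ {L} {h} = from-true (h ∈? L)
    where
    from-true : (h∈?L : Dec (h ∈ L)) → does h∈?L ≡ true → h ∈ L
    from-true (yes h∈L) _ = h∈L

  ⟪⟫⇒∉ : ∀ {L h} → ⟪ L ⟫ h ≡ false → h ∉ L
  ⟪⟫⇒∉ h∉L h∈L with ≡.trans (≡.sym (∈⇒⟪⟫ h∈L)) h∉L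
  ... | ()

  ⟪⟫-cons : ∀ {p L h} → h ≢ p → ⟪ p ∷ L ⟫ h ≡ ⟪ L ⟫ h
  ⟪⟫-cons {p} {L} {h} h≢p = by-cases (h ∈? L)
    where
    by-cases : Dec (h ∈ L) → ⟪ p ∷ L ⟫ h ≡ ⟪ L ⟫ h
    by-cases (yes h∈L) = ≡.trans (∈⇒⟪⟫ {p ∷ L} (there h∈L)) (≡.sym (∈⇒⟪⟫ {L} h∈L))
    by-cases (no  h∉L) = ≡.trans (∉⇒⟪⟫ {p ∷ L} λ { (here h≡p) → h≢p h≡p ; (there h∈L) → h∉L h∈L })
                                 (≡.sym (∉⇒⟪⟫ {L} h∉L))

  outside-list : ∀ (T : HSet) {L h} → T ⊆ ⟪ L ⟫ → h ∉ L → T h ≡ false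
  outside-list T {h = h} T⊆L h∉L with T h in Th
  ... | true  = ⊥-elim (h∉L (⟪⟫⇒∈ (T⊆L h Th)))
  ... | false = ≡.refl

  member≢nonmember : ∀ (T : HSet) {h s} → T h ≡ true → T s ≡ false → h ≢ s
  member≢nonmember T Th Ts ≡.refl with ≡.trans (≡.sym Th) Ts
  ... | ()

  ∈-─ : ∀ {xs : List Hyp} {y h} (y∈xs : y ∈ xs) → h ∈ xs → h ≢ y → h ∈ (xs ─ y∈xs)
  ∈-─ (here ≡.refl)  (here h≡y)  h≢y = ⊥-elim (h≢y h≡y)
  ∈-─ (here ≡.refl)  (there h∈)  _   = h∈
  ∈-─ (there y∈xs)   (here h≡x)  _   = here h≡x
  ∈-─ (there y∈xs)   (there h∈)  h≢y = there (∈-─ y∈xs h∈ h≢y)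

  edge : Fin n → Fin n → Hyp
  edge i j with FinP.<-cmp i j
  ... | tri< _ _ _ = just (i , j)
  ... | tri≈ _ _ _ = just (i , j)
  ... | tri> _ _ _ = just (j , i)

  edge-cases : ∀ i j → edge i j ≡ just (i , j) ⊎ edge i j ≡ just (j , i)
  edge-cases i j with FinP.<-cmp i j
  ... | tri< _ _ _ = inj₁ ≡.refl
  ... | tri≈ _ _ _ = inj₁ ≡.refl
  ... | tri> _ _ _ = inj₂ ≡.refl

  edge-ordered : ∀ {i j} → i Fin.< j → edge i j ≡ just (i , j)
  edge-ordered {i} {j} i<j with FinP.<-cmp i j
  ... | tri< _ _ _   = ≡.refl
  ... | tri≈ _ _ _   = ≡.refl
  ... | tri> _ _ j<i = ⊥-elim (FinP.<-asym i<j j<i)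

  edge-reversed : ∀ {i j} → j Fin.< i → edge i j ≡ just (j , i)
  edge-reversed {i} {j} j<i with FinP.<-cmp i j
  ... | tri< i<j _ _ = ⊥-elim (FinP.<-asym i<j j<i)
  ... | tri≈ _ i≡j _ = ⊥-elim (FinP.<⇒≢ j<i (≡.sym i≡j))
  ... | tri> _ _ _   = ≡.refl

  edge≢nothing : ∀ {i j} → edge i j ≢ nothing
  edge≢nothing {i} {j} edge≡nothing with edge-cases i j
  ... | inj₁ eq with ≡.trans (≡.sym eq) edge≡nothing
  ...   | ()
  edge≢nothing {i} {j} edge≡nothing | inj₂ eq with ≡.trans (≡.sym eq) edge≡nothing
  ...   | ()

  edge-valid : (∀ i j → adj i j ≡ adj j i) → ∀ {i j} → i ≢ j → adj i j ≡ true → Valid (edge i j)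
  edge-valid adj-sym {i} {j} i≢j i~j with FinP.<-cmp i j
  ... | tri< i<j _ _ = i<j , i~j
  ... | tri≈ _ i≡j _ = ⊥-elim (i≢j i≡j)
  ... | tri> _ _ j<i = j<i , ≡.trans (adj-sym j i) i~j

  interior≢boundary : ∀ {i b} → B i ≡ false → B b ≡ true → i ≢ b
  interior≢boundary Bi Bb ≡.refl with ≡.trans (≡.sym Bi) Bb
  ... | ()

  edge-injective : ∀ {i b b'} → B i ≡ false → B b ≡ true → B b' ≡ true →
                   edge i b ≡ edge i b' → b ≡ b'
  edge-injective {i} {b} {b'} Bi Bb Bb' eq with edge-cases i b | edge-cases i b'
  ... | inj₁ e₁ | inj₁ e₂ = ,-injectiveʳ (just-injective (≡.trans (≡.sym e₁) (≡.trans eq e₂)))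
  ... | inj₁ e₁ | inj₂ e₂ =
    ⊥-elim (interior≢boundary Bi Bb' (,-injectiveˡ (just-injective (≡.trans (≡.sym e₁) (≡.trans eq e₂)))))
  ... | inj₂ e₁ | inj₁ e₂ =
    ⊥-elim (interior≢boundary Bi Bb (≡.sym (,-injectiveˡ (just-injective (≡.trans (≡.sym e₁) (≡.trans eq e₂))))))
  ... | inj₂ e₁ | inj₂ e₂ = ,-injectiveˡ (just-injective (≡.trans (≡.sym e₁) (≡.trans eq e₂)))

  interior-normal : ∀ {i j} → B i ≡ false → B j ≡ false →
                    ∀ x → normal (just (i , j)) x ≡ e (just i) x - e (just j) x
  interior-normal Bi Bj x rewrite Bi | Bj = ≡.refl

  boundary-normal : ∀ {i b} → B i ≡ false → B b ≡ true →
                    ∀ x → normal (edge i b) x ≡ e (just i) x - u b * e nothing x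
  boundary-normal {i} {b} Bi Bb x with edge-cases i b
  ... | inj₁ eq rewrite eq | Bi | Bb = ≡.refl
  ... | inj₂ eq rewrite eq | Bi | Bb = ≡.refl

  data Kind (p : Hyp) : Set c where
    origin   : p ≡ nothing → Kind p
    interior : ∀ i j → B i ≡ false → B j ≡ false → i ≢ j →
               (∀ x → normal p x ≡ e (just i) x - e (just j) x) → Kind p
    boundary : ∀ i b → B i ≡ false → B b ≡ true → p ≡ edge i b → Kind p

  kind : (∀ i j → B i ≡ true → B j ≡ true → adj i j ≡ false) → ∀ {p} → Valid p → Kind p
  kind _ {nothing} _ = origin ≡.refl
  kind boundary-independent {just (i , j)} (i<j , i~j) with B i in Bi | B j in Bj
  ... | false | false = interior i j Bi Bj (FinP.<⇒≢ i<j) (interior-normal Bi Bj)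
  ... | false | true  = boundary i j Bi Bj (≡.sym (edge-ordered i<j))
  ... | true  | false = boundary j i Bj Bi (≡.sym (edge-reversed i<j))
  ... | true  | true  with ≡.trans (≡.sym i~j) (boundary-independent i j Bi Bj)
  ... | ()

  e-same : ∀ y → e y y ≈ 1#
  e-same y with Maybe-≡-dec _≟ᶠ_ y y
  ... | yes _   = refl
  ... | no y≢y  = ⊥-elim (y≢y ≡.refl)

  e-diff : ∀ {y x} → y ≢ x → e y x ≈ 0#
  e-diff {y} {x} y≢x with Maybe-≡-dec _≟ᶠ_ y x
  ... | yes y≡x = ⊥-elim (y≢x y≡x)
  ... | no _    = refl

  minus-zero : ∀ {x y z} → x ≈ z → y ≈ 0# → x - y ≈ z
  minus-zero x≈z y≈0 = trans (+-cong x≈z (trans (-‿cong y≈0) ε⁻¹≈ε)) (+-identityʳ _)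

  zero-minus : ∀ {x y z} → x ≈ 0# → y ≈ z → x - y ≈ - z
  zero-minus x≈0 y≈z = trans (+-cong x≈0 (-‿cong y≈z)) (+-identityˡ _)

  origin-at-interior : ∀ t → normal nothing (just t) ≈ 0#
  origin-at-interior t = e-diff {nothing} {just t} λ ()

  module _ {p i j} (i≢j : i ≢ j) (normal-p : ∀ x → normal p x ≡ e (just i) x - e (just j) x) where

    interior-at-i : normal p (just i) ≈ 1#
    interior-at-i = trans (reflexive (normal-p _)) (minus-zero (e-same (just i)) (e-diff {just j} {just i} (i≢j ∘ ≡.sym ∘ just-injective)))

    interior-at-j : normal p (just j) ≈ - 1#
    interior-at-j = trans (reflexive (normal-p _)) (zero-minus (e-diff {just i} {just j} (i≢j ∘ just-injective)) (e-same (just j)))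

  module _ {i b} (Bi : B i ≡ false) (Bb : B b ≡ true) where

    boundary-at-i : normal (edge i b) (just i) ≈ 1#
    boundary-at-i = trans (reflexive (boundary-normal Bi Bb _))
                          (minus-zero (e-same (just i)) (trans (*-congˡ (origin-at-interior i)) (zeroʳ _)))

    boundary-at-other : ∀ {t} → t ≢ i → normal (edge i b) (just t) ≈ 0#
    boundary-at-other {t} t≢i =
      trans (reflexive (boundary-normal Bi Bb _))
            (minus-zero (e-diff {just i} {just t} (t≢i ∘ ≡.sym ∘ just-injective)) (trans (*-congˡ (origin-at-interior t)) (zeroʳ _)))

    boundary-at-origin : normal (edge i b) nothing ≈ - u b
    boundary-at-origin = trans (reflexive (boundary-normal Bi Bb _))
                               (zero-minus (e-diff {just i} {nothing} λ ()) (trans (*-congˡ (e-same nothing)) (*-identityʳ _)))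

  unit-coordinate : ∀ {p} → Kind p → Σ Coord λ x → InAmbient x × normal p x ≈ 1#
  unit-coordinate (origin ≡.refl)                      = nothing , tt , e-same nothing
  unit-coordinate {p} (interior i j Bi _ i≢j normal-p) = just i , Bi , interior-at-i {p} i≢j normal-p
  unit-coordinate (boundary i b Bi Bb ≡.refl)          = just i , Bi , boundary-at-i Bi Bb

  module Independence (isField : IsField K) where
    open FieldFacts K isField
    open IntegerCoefficientSolver K using (solve; _:=_; _:+_; _:*_; _:-_; :-_; con)

    record Vanishes (α : Carrier) (p : Hyp) (β : Carrier) (w : Hyp) : Set ℓ where
      constructor vanishing
      field vanishes-at : ∀ x → InAmbient x → α * normal p x + β * normal w x ≈ 0#
    open Vanishes

    vanishes-swap : ∀ {α p β w} → Vanishes α p β w → Vanishes β w α p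
    vanishes-swap van = vanishing λ x ax → trans (+-comm _ _) (vanishes-at van x ax)

    separated : ∀ {α p β w x} → InAmbient x → ¬ normal p x ≈ 0# → normal w x ≈ 0# →
                Vanishes α p β w → α ≈ 0#
    separated {x = x} ax p≉0 w≈0 van = cancel p≉0
      (trans (sym (trans (+-congˡ (trans (*-congˡ w≈0) (zeroʳ _))) (+-identityʳ _))) (vanishes-at van x ax))

    both-zero : ∀ {α p β w} → Kind p → Kind w → Vanishes α p β w →
                α ≈ 0# ⊎ β ≈ 0# → α ≈ 0# × β ≈ 0#
    both-zero κp κw van (inj₁ α≈0) with unit-coordinate κw
    ... | x , ax , w≈1 = α≈0 , cancel (≈1⇒≉0 w≈1)
      (trans (sym (trans (+-congʳ (trans (*-congʳ α≈0) (zeroˡ _))) (+-identityˡ _))) (vanishes-at van x ax))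
    both-zero κp κw van (inj₂ β≈0) with unit-coordinate κp
    ... | x , ax , p≈1 = cancel (≈1⇒≉0 p≈1)
      (trans (sym (trans (+-congˡ (trans (*-congʳ β≈0) (zeroˡ _))) (+-identityʳ _))) (vanishes-at van x ax)) , β≈0

    -- Two boundary edges at the same interior vertex i, towards boundary
    -- nodes with different values of u, are independent: evaluating at x_i
    -- and at x₀ gives a 2×2 system whose determinant is u(b) − u(b').
    edges-at-vertex : ∀ {α β i b b'} → B i ≡ false → B b ≡ true → B b' ≡ true →
                      ¬ u b - u b' ≈ 0# → Vanishes α (edge i b') β (edge i b) → α ≈ 0#
    edges-at-vertex {α} {β} {i} {b} {b'} Bi Bb Bb' u≉u' van = cancel u≉u' (begin
      α * (u b - u b')                                      ≈⟨ eliminate α β (u b) (u b') ⟩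
      (α * - u b' + β * - u b) + u b * (α * 1# + β * 1#)    ≈⟨ +-cong at-origin (trans (*-congˡ at-i) (zeroʳ _)) ⟩
      0# + 0#                                               ≈⟨ +-identityʳ 0# ⟩
      0#                                                    ∎)
      where
      at-i : α * 1# + β * 1# ≈ 0#
      at-i = trans (sym (+-cong (*-congˡ (boundary-at-i Bi Bb')) (*-congˡ (boundary-at-i Bi Bb))))
                   (vanishes-at van (just i) Bi)
      at-origin : α * - u b' + β * - u b ≈ 0#
      at-origin = trans (sym (+-cong (*-congˡ (boundary-at-origin Bi Bb')) (*-congˡ (boundary-at-origin Bi Bb))))
                        (vanishes-at van nothing tt)
      eliminate : ∀ α β x y → α * (x - y) ≈ (α * - y + β * - x) + x * (α * 1# + β * 1#)
      eliminate = solve 4 (λ α β x y →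
        α :* (x :- y) := (α :* (:- y) :+ β :* (:- x)) :+ x :* (α :* con (+ 1) :+ β :* con (+ 1))) refl

    pair-relation : ∀ {p w} → p ≢ w → (T : HSet) → T ⊆ ⟪ p ∷ w ∷ [] ⟫ → Dependent T →
                    Σ Carrier λ α → Σ Carrier λ β → (¬ α ≈ 0# ⊎ ¬ β ≈ 0#) × Vanishes α p β w
    pair-relation {p} {w} p≢w T T⊆ (cf , off , (h , Th , cfh≉0) , comb≈0) =
      cf p , cf w , nontrivial (⟪⟫⇒∈ (T⊆ h Th)) cfh≉0 , vanishing combination≈0
      where
      outside : ∀ h → h ≢ p → h ≢ w → cf h ≈ 0#
      outside h h≢p h≢w = off h (outside-list T {p ∷ w ∷ []} T⊆
        λ { (here h≡p) → h≢p h≡p ; (there (here h≡w)) → h≢w h≡w ; (there (there ())) })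
      split : ∀ h → cf h ≈ point p (cf p) h + point w (cf w) h
      split h with h ≟ᴴ p | h ≟ᴴ w
      ... | yes ≡.refl | yes h≡w = ⊥-elim (p≢w h≡w)
      ... | yes ≡.refl | no _       = sym (+-identityʳ _)
      ... | no _       | yes ≡.refl = sym (+-identityˡ _)
      ... | no h≢p     | no h≢w     = trans (outside h h≢p h≢w) (sym (+-identityʳ 0#))
      combination≈0 : ∀ x → InAmbient x → cf p * normal p x + cf w * normal w x ≈ 0#
      combination≈0 x ax = begin
        cf p * normal p x + cf w * normal w x
          ≈⟨ +-cong (lincomb-point p (cf p) x) (lincomb-point w (cf w) x) ⟨
        lincomb (point p (cf p)) x + lincomb (point w (cf w)) x
          ≈⟨ lincomb-+ (point p (cf p)) (point w (cf w)) x ⟨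
        lincomb (λ h → point p (cf p) h + point w (cf w) h) x
          ≈⟨ lincomb-cong split x ⟨
        lincomb cf x
          ≈⟨ comb≈0 x ax ⟩
        0# ∎
      nontrivial : ∀ {h} → h ∈ p ∷ w ∷ [] → ¬ cf h ≈ 0# → ¬ cf p ≈ 0# ⊎ ¬ cf w ≈ 0#
      nontrivial (here ≡.refl)         cfh≉0 = inj₁ cfh≉0
      nontrivial (there (here ≡.refl)) cfh≉0 = inj₂ cfh≉0

    singleton-independent : ∀ {p} → Kind p → (T : HSet) → T ⊆ ⟪ p ∷ [] ⟫ → ¬ Dependent T
    singleton-independent {p} κ T T⊆ (cf , off , (h , Th , cfh≉0) , comb≈0) =
      nonzero (⟪⟫⇒∈ (T⊆ h Th)) cfh≉0
      where
      concentrated : ∀ h → cf h ≈ point p (cf p) h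
      concentrated h with h ≟ᴴ p
      ... | yes ≡.refl = refl
      ... | no h≢p     = off h (outside-list T {p ∷ []} T⊆ λ { (here h≡p) → h≢p h≡p ; (there ()) })
      cf-p≈0 : cf p ≈ 0#
      cf-p≈0 with unit-coordinate κ
      ... | x , ax , p≈1 = cancel (≈1⇒≉0 p≈1)
        (trans (sym (trans (lincomb-cong concentrated x) (lincomb-point p (cf p) x))) (comb≈0 x ax))
      nonzero : ∀ {h} → h ∈ p ∷ [] → ¬ cf h ≈ 0# → ⊥
      nonzero (here ≡.refl) cfh≉0 = cfh≉0 cf-p≈0

module Star {c ℓ} (K : CommutativeRing c ℓ) (isField : IsField K)
  (n : ℕ) (adj : Adj n) (B : Fin n → Bool) (u : Fin n → CommutativeRing.Carrier K)
  (adj-sym : ∀ i j → adj i j ≡ adj j i)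
  (boundary-independent : ∀ i j → B i ≡ true → B j ≡ true → adj i j ≡ false)
  (u-injective : ∀ i j → B i ≡ true → B j ≡ true → CommutativeRing._≈_ K (u i) (u j) → i ≡ j)
  (v : Fin n) (Bv : B v ≡ false) (b₁ b₂ b₃ : Fin n)
  (b₁≢b₂ : b₁ ≢ b₂) (b₁≢b₃ : b₁ ≢ b₃) (b₂≢b₃ : b₂ ≢ b₃)
  (Bb₁ : B b₁ ≡ true) (Bb₂ : B b₂ ≡ true) (Bb₃ : B b₃ ≡ true)
  (v~b₁ : adj v b₁ ≡ true) (v~b₂ : adj v b₂ ≡ true) (v~b₃ : adj v b₃ ≡ true) where
  open CommutativeRing K hiding (zero)
  open Arrangement K n adj B u
  open ArrangementFacts K n adj B u
  open Independence isField
  open FieldFacts K isField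
  open PlaneIdentity K
  open IntegerCoefficientSolver K using (solve; _:=_; _:+_; _:*_; _:-_; :-_; con)
  open import Data.List.Membership.DecPropositional _≟ᴴ_ using (_∈_; _∉_)

  nb : Fin 3 → Fin n
  nb 0F = b₁
  nb 1F = b₂
  nb 2F = b₃

  nb-boundary : ∀ k → B (nb k) ≡ true
  nb-boundary 0F = Bb₁
  nb-boundary 1F = Bb₂
  nb-boundary 2F = Bb₃

  nb-adjacent : ∀ k → adj v (nb k) ≡ true
  nb-adjacent 0F = v~b₁
  nb-adjacent 1F = v~b₂
  nb-adjacent 2F = v~b₃

  nb-injective : ∀ {k l} → nb k ≡ nb l → k ≡ l
  nb-injective {0F} {0F} _  = ≡.refl
  nb-injective {0F} {1F} eq = ⊥-elim (b₁≢b₂ eq)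
  nb-injective {0F} {2F} eq = ⊥-elim (b₁≢b₃ eq)
  nb-injective {1F} {0F} eq = ⊥-elim (b₁≢b₂ (≡.sym eq))
  nb-injective {1F} {1F} _  = ≡.refl
  nb-injective {1F} {2F} eq = ⊥-elim (b₂≢b₃ eq)
  nb-injective {2F} {0F} eq = ⊥-elim (b₁≢b₃ (≡.sym eq))
  nb-injective {2F} {1F} eq = ⊥-elim (b₂≢b₃ (≡.sym eq))
  nb-injective {2F} {2F} _  = ≡.refl

  u-separates : ∀ {b b'} → B b ≡ true → B b' ≡ true → b ≢ b' → ¬ u b - u b' ≈ 0#
  u-separates Bb Bb' b≢b' d = b≢b' (u-injective _ _ Bb Bb' (difference-zero d))

  star : Fin 4 → Hyp
  star zero    = nothing
  star (suc k) = edge v (nb k)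

  star-valid : ∀ k → Valid (star k)
  star-valid zero    = tt
  star-valid (suc k) = edge-valid adj-sym (interior≢boundary Bv (nb-boundary k)) (nb-adjacent k)

  star-kind : ∀ k → Kind (star k)
  star-kind zero    = origin ≡.refl
  star-kind (suc k) = boundary v (nb k) Bv (nb-boundary k) ≡.refl

  star-injective : ∀ {k l} → star k ≡ star l → k ≡ l
  star-injective {zero}  {zero}  _  = ≡.refl
  star-injective {zero}  {suc l} eq = ⊥-elim (edge≢nothing (≡.sym eq))
  star-injective {suc k} {zero}  eq = ⊥-elim (edge≢nothing eq)
  star-injective {suc k} {suc l} eq =
    ≡.cong suc (nb-injective (edge-injective Bv (nb-boundary k) (nb-boundary l) eq))

  -- Coordinates of the star normals in the basis (e_v, e₀).

  vcoef ocoef : Fin 4 → Carrier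
  vcoef zero    = 0#
  vcoef (suc k) = 1#
  ocoef zero    = 1#
  ocoef (suc k) = - u (nb k)

  star-normal : ∀ k x → normal (star k) x ≈ vcoef k * e (just v) x + ocoef k * e nothing x
  star-normal zero    x = solve 2 (λ y z → z := con (+ 0) :* y :+ con (+ 1) :* z) refl _ _
  star-normal (suc k) x = trans (reflexive (boundary-normal Bv (nb-boundary k) x))
    (solve 3 (λ y w z → y :- w :* z := con (+ 1) :* y :+ (:- w) :* z) refl _ _ _)

  det : Fin 4 → Fin 4 → Carrier
  det k l = det₂ (vcoef k) (ocoef k) (vcoef l) (ocoef l)

  det-nonzero : ∀ {k l} → k ≢ l → ¬ det k l ≈ 0#
  det-nonzero {zero}  {zero}  k≢l = ⊥-elim (k≢l ≡.refl)
  det-nonzero {zero}  {suc l} _   = ≈-1⇒≉0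
    (solve 1 (λ x → con (+ 0) :* (:- x) :- con (+ 1) :* con (+ 1) := :- con (+ 1)) refl _)
  det-nonzero {suc k} {zero}  _   = ≈1⇒≉0
    (solve 1 (λ x → con (+ 1) :* con (+ 1) :- con (+ 0) :* (:- x) := con (+ 1)) refl _)
  det-nonzero {suc k} {suc l} k≢l d =
    u-separates (nb-boundary k) (nb-boundary l) (k≢l ∘ ≡.cong suc ∘ nb-injective)
      (trans (sym (solve 2 (λ x y → con (+ 1) :* (:- y) :- con (+ 1) :* (:- x) := x :- y) refl _ _)) d)

  -- Three distinct star hyperplanes are dependent, with the 2×2 minors as
  -- coefficients.
  star-dependent : ∀ {a b c} → a ≢ b → a ≢ c → b ≢ c → Dependent ⟪ star a ∷ star b ∷ star c ∷ [] ⟫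
  star-dependent {a} {b} {c} a≢b a≢c b≢c =
    cf , off , (star c , ∈⇒⟪⟫ {star a ∷ star b ∷ star c ∷ []} (there (there (here ≡.refl))) , cf-c≉0) , comb≈0
    where
    mass-a mass-b mass-c cf : Hyp → Carrier
    mass-a = point (star a) (det b c)
    mass-b = point (star b) (det c a)
    mass-c = point (star c) (det a b)
    cf h = mass-a h + (mass-b h + mass-c h)
    off : ∀ h → ⟪ star a ∷ star b ∷ star c ∷ [] ⟫ h ≡ false → cf h ≈ 0#
    off h h-out = trans (+-cong (point-off _ (h∉ ∘ here))
                                (trans (+-cong (point-off _ (h∉ ∘ there ∘ here))
                                               (point-off _ (h∉ ∘ there ∘ there ∘ here)))
                                       (+-identityʳ 0#)))
                        (+-identityʳ 0#)
      where
      h∉ : h ∉ star a ∷ star b ∷ star c ∷ []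
      h∉ = ⟪⟫⇒∉ {star a ∷ star b ∷ star c ∷ []} h-out
    cf-c≉0 : ¬ cf (star c) ≈ 0#
    cf-c≉0 z = det-nonzero a≢b (trans (sym cf-c) z)
      where
      cf-c : cf (star c) ≈ det a b
      cf-c = trans (+-cong (point-off _ (a≢c ∘ ≡.sym ∘ star-injective))
                           (+-cong (point-off _ (b≢c ∘ ≡.sym ∘ star-injective)) (point-at (star c) _)))
                   (trans (+-identityˡ _) (+-identityˡ _))
    comb≈0 : ∀ x → InAmbient x → lincomb cf x ≈ 0#
    comb≈0 x _ = trans (trans (lincomb-+ mass-a (λ h → mass-b h + mass-c h) x)
                              (+-congˡ (lincomb-+ mass-b mass-c x)))
                       (trans (+-cong (mass a (det b c)) (+-cong (mass b (det c a)) (mass c (det a b))))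
                              (cofactor-relation _ _ _ _ _ _ _ _))
      where
      mass : ∀ k γ → lincomb (point (star k) γ) x ≈ γ * (vcoef k * e (just v) x + ocoef k * e nothing x)
      mass k γ = trans (lincomb-point (star k) γ x) (*-congˡ (star-normal k x))

  -- In a vanishing combination of the normals of a hyperplane p and of a
  -- different star hyperplane, one coefficient is zero: some interior
  -- coordinate is seen by only one of the two normals, unless both are
  -- boundary edges at v, which edges-at-vertex handles.
  one-coefficient-zero : ∀ {p α β} k → Kind p → p ≢ star k → Vanishes α p β (star k) → α ≈ 0# ⊎ β ≈ 0#
  one-coefficient-zero zero (origin ≡.refl) p≢w _ = ⊥-elim (p≢w ≡.refl)
  one-coefficient-zero {p} zero (interior i j Bi _ i≢j normal-p) _ van =
    inj₁ (separated Bi (≈1⇒≉0 (interior-at-i {p} i≢j normal-p)) (origin-at-interior i) van)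
  one-coefficient-zero zero (boundary i b Bi Bb ≡.refl) _ van =
    inj₁ (separated Bi (≈1⇒≉0 (boundary-at-i Bi Bb)) (origin-at-interior i) van)
  one-coefficient-zero (suc k) (origin ≡.refl) _ van =
    inj₂ (separated Bv (≈1⇒≉0 (boundary-at-i Bv (nb-boundary k))) (origin-at-interior v) (vanishes-swap van))
  one-coefficient-zero {p} (suc k) (interior i j Bi Bj i≢j normal-p) _ van with i ≟ᶠ v
  ... | no i≢v = inj₁ (separated Bi (≈1⇒≉0 (interior-at-i {p} i≢j normal-p))
                                 (boundary-at-other Bv (nb-boundary k) i≢v) van)
  ... | yes ≡.refl = inj₁ (separated Bj (≈-1⇒≉0 (interior-at-j {p} i≢j normal-p))
                                     (boundary-at-other Bv (nb-boundary k) (i≢j ∘ ≡.sym)) van)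
  one-coefficient-zero (suc k) (boundary i b Bi Bb ≡.refl) p≢w van with i ≟ᶠ v
  ... | no i≢v = inj₁ (separated Bi (≈1⇒≉0 (boundary-at-i Bi Bb)) (boundary-at-other Bv (nb-boundary k) i≢v) van)
  ... | yes ≡.refl with b ≟ᶠ nb k
  ...   | yes ≡.refl = ⊥-elim (p≢w ≡.refl)
  ...   | no b≢bk    = inj₁ (edges-at-vertex Bv (nb-boundary k) Bb
                                             (u-separates (nb-boundary k) Bb (b≢bk ∘ ≡.sym)) van)

  star-independent : ∀ {p α β} k → Kind p → p ≢ star k → Vanishes α p β (star k) → α ≈ 0# × β ≈ 0#
  star-independent k κ p≢w van = both-zero κ (star-kind k) van (one-coefficient-zero k κ p≢w van)

  no-dependent-within : ∀ {p} → Valid p → ∀ k (T : HSet) → T ⊆ ⟪ p ∷ star k ∷ [] ⟫ → ¬ Dependent T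
  no-dependent-within {p} valid k T T⊆ dep with p ≟ᴴ star k
  ... | yes ≡.refl = singleton-independent (star-kind k) T
        (λ h Th → ∈⇒⟪⟫ {star k ∷ []} {h} (collapse (⟪⟫⇒∈ {star k ∷ star k ∷ []} (T⊆ h Th)))) dep
    where
    collapse : ∀ {h} → h ∈ star k ∷ star k ∷ [] → h ∈ star k ∷ []
    collapse (here h≡w)         = here h≡w
    collapse (there (here h≡w)) = here h≡w
  ... | no p≢w = trivial (pair-relation p≢w T T⊆ dep)
    where
    trivial : ¬ (Σ Carrier λ α → Σ Carrier λ β → (¬ α ≈ 0# ⊎ ¬ β ≈ 0#) × Vanishes α p β (star k))
    trivial (α , β , inj₁ α≉0 , van) = α≉0 (proj₁ (star-independent k (kind boundary-independent valid) p≢w van))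
    trivial (α , β , inj₂ β≉0 , van) = β≉0 (proj₂ (star-independent k (kind boundary-independent valid) p≢w van))

  -- Three distinct star hyperplanes form a circuit: a proper subset misses
  -- one of them and so lies within the other two.
  star-circuit : ∀ {a b c} → a ≢ b → a ≢ c → b ≢ c → Circuit ⟪ star a ∷ star b ∷ star c ∷ [] ⟫
  star-circuit {a} {b} {c} a≢b a≢c b≢c = valid , star-dependent a≢b a≢c b≢c , minimal
    where
    L : List Hyp
    L = star a ∷ star b ∷ star c ∷ []
    valid : InArr ⟪ L ⟫
    valid h h∈ with ⟪⟫⇒∈ {L} {h} h∈
    ... | here ≡.refl                 = star-valid a
    ... | there (here ≡.refl)         = star-valid b
    ... | there (there (here ≡.refl)) = star-valid c
    within-rest : ∀ {s} (s∈L : s ∈ L) (T : HSet) → T ⊆ ⟪ L ─ s∈L ⟫ → ¬ Dependent T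
    within-rest (here _)                 = no-dependent-within (star-valid b) c
    within-rest (there (here _))         = no-dependent-within (star-valid a) c
    within-rest (there (there (here _))) = no-dependent-within (star-valid a) b
    minimal : ∀ T → T ⊂ ⟪ L ⟫ → ¬ Dependent T
    minimal T (T⊆L , s , Ls , Ts) = within-rest s∈L T λ h Th →
      ∈⇒⟪⟫ {L ─ s∈L} (∈-─ s∈L (⟪⟫⇒∈ {L} {h} (T⊆L h Th)) (member≢nonmember T Th Ts))
      where
      s∈L : s ∈ L
      s∈L = ⟪⟫⇒∈ {L} {s} Ls

  module _ (rank : Hyp → ℕ) (a : Fin 4) (a-least : ∀ k → rank (star a) ℕ.≤ rank (star k)) where

    -- {x, y} is the broken circuit of the circuit {a, x, y}.
    broken-pair : ∀ {x y} → a ≢ x → a ≢ y → x ≢ y → BrokenCircuit rank ⟪ star x ∷ star y ∷ [] ⟫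
    broken-pair {x} {y} a≢x a≢y x≢y =
      ⟪ C ⟫ , star-circuit a≢x a≢y x≢y , star a , (∈⇒⟪⟫ {C} (here ≡.refl) , least) ,
      ∉⇒⟪⟫ {star x ∷ star y ∷ []} a-missing , (λ h h≢a → ≡.sym (⟪⟫-cons {L = star x ∷ star y ∷ []} h≢a))
      where
      C : List Hyp
      C = star a ∷ star x ∷ star y ∷ []
      least : ∀ h → ⟪ C ⟫ h ≡ true → rank (star a) ℕ.≤ rank h
      least h h∈ with ⟪⟫⇒∈ {C} {h} h∈
      ... | here ≡.refl                 = a-least a
      ... | there (here ≡.refl)         = a-least x
      ... | there (there (here ≡.refl)) = a-least y
      a-missing : star a ∉ star x ∷ star y ∷ []
      a-missing (here eq)         = a≢x (star-injective eq)
      a-missing (there (here eq)) = a≢y (star-injective eq)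

    -- It is minimal: a broken circuit T ⊂ {x, y}, obtained from a circuit C by
    -- removing h₀, would put C within {h₀, star y} or {h₀, star x}.
    minimal-broken-pair : ∀ {x y} → a ≢ x → a ≢ y → x ≢ y →
                          MinimalBrokenCircuit rank ⟪ star x ∷ star y ∷ [] ⟫
    minimal-broken-pair {x} {y} a≢x a≢y x≢y = broken-pair a≢x a≢y x≢y , minimal
      where
      S : List Hyp
      S = star x ∷ star y ∷ []
      minimal : ∀ T → T ⊂ ⟪ S ⟫ → ¬ BrokenCircuit rank T
      minimal T (T⊆S , s , Ss , Ts) (C , (C-valid , C-dependent , _) , h₀ , (Ch₀ , _) , _ , T≡C) =
        within (⟪⟫⇒∈ {S} {s} Ss) C-dependent
        where
        C⊆ : (s∈S : s ∈ S) → C ⊆ ⟪ h₀ ∷ (S ─ s∈S) ⟫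
        C⊆ s∈S h Ch = ∈⇒⟪⟫ {h₀ ∷ (S ─ s∈S)} (by-cases (h ≟ᴴ h₀))
          where
          by-cases : Dec (h ≡ h₀) → h ∈ h₀ ∷ (S ─ s∈S)
          by-cases (yes h≡h₀) = here h≡h₀
          by-cases (no h≢h₀)  = there (∈-─ s∈S (⟪⟫⇒∈ {S} {h} (T⊆S h Th)) (member≢nonmember T Th Ts))
            where
            Th : T h ≡ true
            Th = ≡.trans (T≡C h h≢h₀) Ch
        within : (s∈S : s ∈ S) → ¬ Dependent C
        within s∈S@(here _)         = no-dependent-within (C-valid h₀ Ch₀) y C (C⊆ s∈S)
        within s∈S@(there (here _)) = no-dependent-within (C-valid h₀ Ch₀) x C (C⊆ s∈S)

    overlapping-pairs : Complement a → MBCNotPairwiseDisjoint rank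
    overlapping-pairs (complement x y z a≢x a≢y a≢z x≢y x≢z y≢z) =
      ⟪ star x ∷ star y ∷ [] ⟫ , ⟪ star x ∷ star z ∷ [] ⟫ ,
      minimal-broken-pair a≢x a≢y x≢y , minimal-broken-pair a≢x a≢z x≢z ,
      (star y , differ-at-y) ,
      (star x , ∈⇒⟪⟫ {star x ∷ star y ∷ []} (here ≡.refl) , ∈⇒⟪⟫ {star x ∷ star z ∷ []} (here ≡.refl))
      where
      y-missing : star y ∉ star x ∷ star z ∷ []
      y-missing (here eq)         = x≢y (≡.sym (star-injective eq))
      y-missing (there (here eq)) = y≢z (star-injective eq)
      differ-at-y : ⟪ star x ∷ star y ∷ [] ⟫ (star y) ≢ ⟪ star x ∷ star z ∷ [] ⟫ (star y)
      differ-at-y eq = y-missing (⟪⟫⇒∈ {star x ∷ star z ∷ []} {star y}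
        (≡.trans (≡.sym eq) (∈⇒⟪⟫ {star x ∷ star y ∷ []} (there (here ≡.refl)))))

  not-pairwise-disjoint : (rank : Hyp → ℕ) → MBCNotPairwiseDisjoint rank
  not-pairwise-disjoint rank with argmin (rank ∘ star)
  ... | a , a-least = overlapping-pairs rank a a-least (complement-of a)

proposition4p15 : {c ℓ : Level} (K : CommutativeRing c ℓ) → IsField K → CharZero K →
    (n : ℕ) (adj : Adj n) → IsSimpleConnectedGraph n adj →
    (B : Fin n → Bool) → IsBoundary n adj B →
    (u : Fin n → CommutativeRing.Carrier K) →
    (∀ i j → B i ≡ true → B j ≡ true → CommutativeRing._≈_ K (u i) (u j) → i ≡ j) →
    (Σ (Fin n) λ v → B v ≡ false × Σ (Fin n) λ b₁ → Σ (Fin n) λ b₂ → Σ (Fin n) λ b₃ →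
       b₁ ≢ b₂ × b₁ ≢ b₃ × b₂ ≢ b₃ ×
       B b₁ ≡ true × B b₂ ≡ true × B b₃ ≡ true ×
       adj v b₁ ≡ true × adj v b₂ ≡ true × adj v b₃ ≡ true) →
    (rank : Arrangement.Hyp K n adj B u → ℕ) → Arrangement.IsTotalOrder K n adj B u rank →
    Arrangement.MBCNotPairwiseDisjoint K n adj B u rank
proposition4p15 K isField _ n adj (adj-sym , _ , _) B (_ , boundary-independent) u u-injective
  (v , Bv , b₁ , b₂ , b₃ , b₁≢b₂ , b₁≢b₃ , b₂≢b₃ , Bb₁ , Bb₂ , Bb₃ , v~b₁ , v~b₂ , v~b₃) rank _ =
  Star.not-pairwise-disjoint K isField n adj B u adj-sym boundary-independent u-injective
    v Bv b₁ b₂ b₃ b₁≢b₂ b₁≢b₃ b₂≢b₃ Bb₁ Bb₂ Bb₃ v~b₁ v~b₂ v~b₃ rank
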